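{- Let $\mathbf C=(C,\leq,\odot,\rightarrow,{}',0,1)$ be a commutative unsharp residuated poset and define, for $x,y\in C$, $x+y:=(x'\odot y')'$, defined if and only if $x\leq y'$. Then $(C,+,{}',0,1)$ is an effect algebra whose induced order coincides with $\leq$.
   Context: For a poset $(P,\leq)$ and $A\subseteq P$: $L(A)=\{x\in P\mid x\leq y\ \forall y\in A\}$, $U(A)=\{x\in P\mid y\leq x\ \forall y\in A\}$; we write $L(a,b)=L(\{a,b\})$, $U(a,b)=U(\{a,b\})$, $LU(A)=L(U(A))$, $UL(a,b)=U(L(\{a,b\}))$. For subsets $A,B$, $A\leq B$ means $x\leq y$ for all $x\in A,y\in B$. Operations are extended elementwise to subsets, e.g. $A\odot y=\{u\odot y\mid u\in A\}$. A partial monoid $(A,\odot,1)$ is a set with a partial binary operation such that $(x\odot y)\odot z$ is defined iff $x\odot(y\odot z)$ is defined and then they are equal, and $x\odot1=1\odot x=x$ for all $x$; it is commutative if $x\odot y$ is defined iff $y\odot x$ is defined and then $x\odot y=y\odot x$. A commutative unsharp residuated poset is a tuple $(C,\leq,\odot,\rightarrow,{}',0,1)$ with $\rightarrow:C^2\to 2^C$ such that for all $x,y,z\in C$: (C1) $(C,\leq,{}',0,1)$ is a bounded poset with an antitone involution ${}'$; (C2) $(C,\odot,1)$ is a commutative partial monoid in which $x\odot y$ is defined iff $x'\leq y$, and $z'\leq x\leq y$ implies $x\odot z\leq y\odot z$; (C3) $L(U(x,y')\odot y)\leq UL(y,z)$ if and only if $LU(x,y')\leq U(y\rightarrow z)$;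 (C4) $x\rightarrow 0=\{x'\}$. An effect algebra is a partial algebra $(E,+,{}',0,1)$ of type $(2,1,0,0)$ where $(E,{}',0,1)$ is an algebra and $+$ is a partial binary operation such that for all $x,y,z\in E$: (E1) $x+y$ is defined iff $y+x$ is defined, and then $x+y=y+x$; (E2) $(x+y)+z$ is defined iff $x+(y+z)$ is defined, and then they are equal; (E3) $x'$ is the unique $u\in E$ with $x+u=1$; (E4) if $1+x$ is defined then $x=0$. Its induced order is $x\leq y$ iff there is $z$ with $x+z=y$. -}

module Defs where

open import Data.Product using (Σ; ∃; _×_; _,_)
open import Data.Sum using (_⊎_)
open import Relation.Binary.PropositionalEquality using (_≡_)
open import Function.Bundles using (_⇔_)

Subset : Set → Set₁
Subset C = C → Set

module PosetOps {C : Set} (_≤_ : C → C → Set) where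
  ⟨_,_⟩ : C → C → Subset C
  ⟨ a , b ⟩ x = (x ≡ a) ⊎ (x ≡ b)

  L : Subset C → Subset C
  L A x = ∀ y → A y → x ≤ y

  U : Subset C → Subset C
  U A x = ∀ y → A y → y ≤ x

  _≤ˢ_ : Subset C → Subset C → Set
  A ≤ˢ B = ∀ x y → A x → B y → x ≤ y

  liftʳ : (C → C → C) → Subset C → C → Subset C
  liftʳ _⊙_ A y w = Σ C (λ u → A u × (w ≡ u ⊙ y))

-- Commutative unsharp residuated poset.
-- The partial operation ⊙ is represented by a total function whose value
-- is only meaningful when it is defined, i.e. when  x ′ ≤ y  (axiom C2).
record CURPoset : Set₁ where
  infix 4 _≤_
  field
    Carrier : Set
    _≤_ : Carrier → Carrier → Set
    _⊙_ : Carrier → Carrier → Carrier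
    _⇒_ : Carrier → Carrier → Subset Carrier
    _′ : Carrier → Carrier
    𝟘 𝟙 : Carrier

  open PosetOps _≤_ public

  Def⊙ : Carrier → Carrier → Set
  Def⊙ x y = x ′ ≤ y

  field
    ≤-refl    : ∀ x → x ≤ x
    ≤-antisym : ∀ {x y} → x ≤ y → y ≤ x → x ≡ y
    ≤-trans   : ∀ {x y z} → x ≤ y → y ≤ z → x ≤ z
    𝟘-least   : ∀ x → 𝟘 ≤ x
    𝟙-greatest : ∀ x → x ≤ 𝟙
    ′-invol   : ∀ x → (x ′) ′ ≡ x
    ′-antitone : ∀ {x y} → x ≤ y → y ′ ≤ x ′
    ⊙-assoc-def : ∀ x y z →
      (Def⊙ x y × Def⊙ (x ⊙ y) z) ⇔ (Def⊙ y z × Def⊙ x (y ⊙ z))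
    ⊙-assoc : ∀ x y z → Def⊙ x y → Def⊙ (x ⊙ y) z →
      (x ⊙ y) ⊙ z ≡ x ⊙ (y ⊙ z)
    ⊙-identityʳ : ∀ x → Def⊙ x 𝟙 × (x ⊙ 𝟙 ≡ x)
    ⊙-identityˡ : ∀ x → Def⊙ 𝟙 x × (𝟙 ⊙ x ≡ x)
    ⊙-comm-def : ∀ x y → Def⊙ x y ⇔ Def⊙ y x
    ⊙-comm : ∀ x y → Def⊙ x y → x ⊙ y ≡ y ⊙ x
    ⊙-mono : ∀ {x y z} → z ′ ≤ x → x ≤ y → (x ⊙ z) ≤ (y ⊙ z)
    C3 : ∀ x y z →
      (L (liftʳ _⊙_ (U ⟨ x , y ′ ⟩) y) ≤ˢ U (L ⟨ y , z ⟩))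
        ⇔ (L (U ⟨ x , y ′ ⟩) ≤ˢ U (y ⇒ z))
    C4 : ∀ x w → (x ⇒ 𝟘) w ⇔ (w ≡ x ′)

-- Effect algebra (E, +, ′, 0, 1); the partial operation + is a total function
-- together with its domain of definition D.
record IsEffectAlgebra {E : Set} (D : E → E → Set) (_+_ : E → E → E)
                       (_′ : E → E) (𝟘 𝟙 : E) : Set where
  field
    comm-def : ∀ x y → D x y ⇔ D y x
    comm     : ∀ x y → D x y → x + y ≡ y + x
    assoc-def : ∀ x y z → (D x y × D (x + y) z) ⇔ (D y z × D x (y + z))
    assoc     : ∀ x y z → D x y → D (x + y) z → (x + y) + z ≡ x + (y + z)
    compl-def : ∀ x → D x (x ′)
    compl     : ∀ x → x + (x ′) ≡ 𝟙
    compl-unique : ∀ x u → D x u → x + u ≡ 𝟙 → u ≡ x ′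
    zero-one : ∀ x → D 𝟙 x → x ≡ 𝟘

InducedLe : {E : Set} (D : E → E → Set) (_+_ : E → E → E) → E → E → Set
InducedLe {E} D _+_ x y = Σ E (λ z → D x z × (x + z ≡ y))

module Derived (C : CURPoset) where
  open CURPoset C
  Def+ : Carrier → Carrier → Set
  Def+ x y = x ≤ y ′
  _+_ : Carrier → Carrier → Carrier
  x + y = ((x ′) ⊙ (y ′)) ′

-- Axiom (C3) with z = 0, read through (C4), is a residuation law:
-- if b ′ ≤ a then a ⊙ b ≤ 0 iff a ≤ b ′. Its two directions give y ′ ⊙ y = 0,
-- hence x + x ′ = 1, and the uniqueness of the orthocomplement. Commutativity
-- and associativity of + are those of ⊙ transported along the involution, and
-- the induced order is ≤ because x + z ≥ x always, while for x ≤ y the element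
-- (x + y ′) ′ is a witness, a fact valid in every effect algebra.
module Submission where

open import Defs
open import Data.Product using (_×_; _,_; proj₁; proj₂)
open import Data.Product.Function.NonDependent.Propositional using (_×-⇔_)
open import Data.Sum using (inj₁; inj₂)
open import Function.Bundles using (_⇔_; mk⇔; Equivalence)
open import Function.Properties.Equivalence using () renaming (refl to ⇔-refl; sym to ⇔-sym)
open import Function.Related.Propositional using (≡⇒; module EquationalReasoning)
open import Relation.Binary.PropositionalEquality

module EffectAlgebraProperties
  {E : Set} {D : E → E → Set} {_+_ : E → E → E} {_′ : E → E} {𝟘 𝟙 : E}
  (isEffectAlgebra : IsEffectAlgebra D _+_ _′ 𝟘 𝟙) where

  open IsEffectAlgebra isEffectAlgebra

  ′-involutive : ∀ x → (x ′) ′ ≡ x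
  ′-involutive x = sym (compl-unique (x ′) x x′⊥x (trans (comm (x ′) x x′⊥x) (compl x)))
    where
    x′⊥x : D (x ′) x
    x′⊥x = Equivalence.to (comm-def x (x ′)) (compl-def x)

  D-′⇒InducedLe : ∀ {x y} → D x (y ′) → InducedLe D _+_ x y
  D-′⇒InducedLe {x} {y} x⊥y′ = t ′ , x⊥t′ , x+t′≡y
    where
    t : E
    t = x + (y ′)

    y′⊥x : D (y ′) x
    y′⊥x = Equivalence.to (comm-def x (y ′)) x⊥y′

    t≡y′+x : t ≡ (y ′) + x
    t≡y′+x = comm x (y ′) x⊥y′

    y′+x⊥t′ : D ((y ′) + x) (t ′)
    y′+x⊥t′ = subst (λ s → D s (t ′)) t≡y′+x (compl-def t)

    reassociated : D x (t ′) × D (y ′) (x + (t ′))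
    reassociated = Equivalence.to (assoc-def (y ′) x (t ′)) (y′⊥x , y′+x⊥t′)

    x⊥t′ : D x (t ′)
    x⊥t′ = proj₁ reassociated

    y′⊥x+t′ : D (y ′) (x + (t ′))
    y′⊥x+t′ = proj₂ reassociated

    y′+[x+t′]≡𝟙 : (y ′) + (x + (t ′)) ≡ 𝟙
    y′+[x+t′]≡𝟙 = begin
      (y ′) + (x + (t ′)) ≡⟨ assoc (y ′) x (t ′) y′⊥x y′+x⊥t′ ⟨
      ((y ′) + x) + (t ′) ≡⟨ cong (_+ (t ′)) t≡y′+x ⟨
      t + (t ′)           ≡⟨ compl t ⟩
      𝟙                   ∎
      where open ≡-Reasoning

    x+t′≡y : x + (t ′) ≡ y
    x+t′≡y = trans (compl-unique (y ′) (x + (t ′)) y′⊥x+t′ y′+[x+t′]≡𝟙) (′-involutive y)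

module CURPosetProperties (C : CURPoset) where

  open CURPoset C
  open Derived C

  ′-injective : ∀ {x y} → x ′ ≡ y ′ → x ≡ y
  ′-injective {x} {y} p = trans (sym (′-invol x)) (trans (cong _′ p) (′-invol y))

  ≤-′′ʳ : ∀ {x y} → x ≤ y → x ≤ (y ′) ′
  ≤-′′ʳ {x} {y} = subst (x ≤_) (sym (′-invol y))

  ′-swap : ∀ {x y} → x ≤ y ′ → y ≤ x ′
  ′-swap {x} {y} p = subst (_≤ x ′) (′-invol y) (′-antitone p)

  𝟙′≡𝟘 : 𝟙 ′ ≡ 𝟘
  𝟙′≡𝟘 = ≤-antisym (subst (𝟙 ′ ≤_) (′-invol 𝟘) (′-antitone (𝟙-greatest (𝟘 ′)))) (𝟘-least (𝟙 ′))

  𝟘′≡𝟙 : 𝟘 ′ ≡ 𝟙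
  𝟘′≡𝟙 = ′-injective (trans (′-invol 𝟘) (sym 𝟙′≡𝟘))

  ⊙-≤ˡ : ∀ {a b} → Def⊙ a b → a ⊙ b ≤ a
  ⊙-≤ˡ {a} {b} a′≤b = subst₂ _≤_ (sym (⊙-comm a b a′≤b)) (proj₂ (⊙-identityˡ a))
                              (⊙-mono a′≤b (𝟙-greatest b))

  pair-upper : ∀ {a b c} → a ≤ c → b ≤ c → U ⟨ a , b ⟩ c
  pair-upper a≤c _   _ (inj₁ refl) = a≤c
  pair-upper _   b≤c _ (inj₂ refl) = b≤c

  𝟘-upper-of-lowers : ∀ b → U (L ⟨ b , 𝟘 ⟩) 𝟘
  𝟘-upper-of-lowers b w w≤b,𝟘 = w≤b,𝟘 𝟘 (inj₂ refl)

  upper-of-⇒𝟘 : ∀ {b c} → b ′ ≤ c → U (b ⇒ 𝟘) c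
  upper-of-⇒𝟘 {b} {c} b′≤c w w∈b⇒𝟘 = subst (_≤ c) (sym (Equivalence.to (C4 b w) w∈b⇒𝟘)) b′≤c

  ⊙≤𝟘⇔≤′ : ∀ {a b} → b ′ ≤ a → (a ⊙ b ≤ 𝟘) ⇔ (a ≤ b ′)
  ⊙≤𝟘⇔≤′ {a} {b} b′≤a = mk⇔ residuate unresiduate
    where
    residuate : a ⊙ b ≤ 𝟘 → a ≤ b ′
    residuate a⊙b≤𝟘 = Equivalence.to (C3 a b 𝟘) lhs a (b ′)
      (λ c c∈U → c∈U a (inj₁ refl))
      (upper-of-⇒𝟘 (≤-refl (b ′)))
      where
      lhs : L (liftʳ _⊙_ (U ⟨ a , b ′ ⟩) b) ≤ˢ U (L ⟨ b , 𝟘 ⟩)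
      lhs v w v∈L _ = ≤-trans (v∈L (a ⊙ b) (a , pair-upper (≤-refl a) b′≤a , refl))
                              (≤-trans a⊙b≤𝟘 (𝟘-least w))

    unresiduate : a ≤ b ′ → a ⊙ b ≤ 𝟘
    unresiduate a≤b′ = Equivalence.from (C3 a b 𝟘) rhs (a ⊙ b) 𝟘
      (λ { _ (u , u∈U , refl) → ⊙-mono b′≤a (u∈U a (inj₁ refl)) })
      (𝟘-upper-of-lowers b)
      where
      rhs : L (U ⟨ a , b ′ ⟩) ≤ˢ U (b ⇒ 𝟘)
      rhs v w v∈L w∈U = ≤-trans (v∈L (b ′) (pair-upper a≤b′ (≤-refl (b ′))))
                                (w∈U (b ′) (Equivalence.from (C4 b (b ′)) refl))

  ⊙-inverseˡ : ∀ y → (y ′) ⊙ y ≡ 𝟘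
  ⊙-inverseˡ y = ≤-antisym (Equivalence.from (⊙≤𝟘⇔≤′ (≤-refl (y ′))) (≤-refl (y ′))) (𝟘-least _)

  +-′ : ∀ x y → (x + y) ′ ≡ (x ′) ⊙ (y ′)
  +-′ x y = ′-invol ((x ′) ⊙ (y ′))

  Def+⇔Def⊙ : ∀ {x y} → Def+ x y ⇔ Def⊙ (x ′) (y ′)
  Def+⇔Def⊙ {x} {y} = ≡⇒ (cong (_≤ y ′) (sym (′-invol x)))

  +-comm : ∀ x y → Def+ x y → x + y ≡ y + x
  +-comm x y x≤y′ = cong _′ (⊙-comm (x ′) (y ′) (Equivalence.to Def+⇔Def⊙ x≤y′))

  +-assoc-def : ∀ x y z → (Def+ x y × Def+ (x + y) z) ⇔ (Def+ y z × Def+ x (y + z))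
  +-assoc-def x y z = begin
    (Def+ x y × Def+ (x + y) z)                        ∼⟨ Def+⇔Def⊙ ×-⇔ ⇔-refl ⟩
    (Def⊙ (x ′) (y ′) × Def⊙ ((x ′) ⊙ (y ′)) (z ′))    ∼⟨ ⊙-assoc-def (x ′) (y ′) (z ′) ⟩
    (Def⊙ (y ′) (z ′) × Def⊙ (x ′) ((y ′) ⊙ (z ′)))    ∼⟨ ⇔-sym Def+⇔Def⊙ ×-⇔ ≡⇒ (cong (_≤ (y ′) ⊙ (z ′)) (′-invol x)) ⟩
    (Def+ y z × x ≤ (y ′) ⊙ (z ′))                     ∼⟨ ⇔-refl ×-⇔ ≡⇒ (cong (x ≤_) (sym (+-′ y z))) ⟩
    (Def+ y z × Def+ x (y + z))                        ∎
    where open EquationalReasoning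

  +-assoc : ∀ x y z → Def+ x y → Def+ (x + y) z → (x + y) + z ≡ x + (y + z)
  +-assoc x y z x≤y′ x+y≤z′ = cong _′ (begin
    ((x + y) ′) ⊙ (z ′)      ≡⟨ cong (_⊙ (z ′)) (+-′ x y) ⟩
    ((x ′) ⊙ (y ′)) ⊙ (z ′)  ≡⟨ ⊙-assoc (x ′) (y ′) (z ′) (Equivalence.to Def+⇔Def⊙ x≤y′) x+y≤z′ ⟩
    (x ′) ⊙ ((y ′) ⊙ (z ′))  ≡⟨ cong ((x ′) ⊙_) (+-′ y z) ⟨
    (x ′) ⊙ ((y + z) ′)      ∎)
    where open ≡-Reasoning

  +-compl : ∀ x → x + (x ′) ≡ 𝟙
  +-compl x = begin
    ((x ′) ⊙ ((x ′) ′)) ′  ≡⟨ cong (λ t → ((x ′) ⊙ t) ′) (′-invol x) ⟩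
    ((x ′) ⊙ x) ′          ≡⟨ cong _′ (⊙-inverseˡ x) ⟩
    𝟘 ′                    ≡⟨ 𝟘′≡𝟙 ⟩
    𝟙                      ∎
    where open ≡-Reasoning

  +-compl-unique : ∀ x u → Def+ x u → x + u ≡ 𝟙 → u ≡ x ′
  +-compl-unique x u x≤u′ x+u≡𝟙 = ′-injective (≤-antisym u′≤x′′ x′′≤u′)
    where
    x′′≤u′ : (x ′) ′ ≤ u ′
    x′′≤u′ = Equivalence.to Def+⇔Def⊙ x≤u′

    x′⊙u′≡𝟘 : (x ′) ⊙ (u ′) ≡ 𝟘
    x′⊙u′≡𝟘 = trans (sym (+-′ x u)) (trans (cong _′ x+u≡𝟙) 𝟙′≡𝟘)

    u′⊙x′≤𝟘 : (u ′) ⊙ (x ′) ≤ 𝟘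
    u′⊙x′≤𝟘 = subst (_≤ 𝟘) (trans (sym x′⊙u′≡𝟘) (⊙-comm (x ′) (u ′) x′′≤u′)) (≤-refl 𝟘)

    u′≤x′′ : u ′ ≤ (x ′) ′
    u′≤x′′ = Equivalence.to (⊙≤𝟘⇔≤′ x′′≤u′) u′⊙x′≤𝟘

  +-zero-one : ∀ x → Def+ 𝟙 x → x ≡ 𝟘
  +-zero-one x 𝟙≤x′ = ′-injective (trans (≤-antisym (𝟙-greatest (x ′)) 𝟙≤x′) (sym 𝟘′≡𝟙))

  +-isEffectAlgebra : IsEffectAlgebra Def+ _+_ _′ 𝟘 𝟙
  +-isEffectAlgebra = record
    { comm-def     = λ x y → mk⇔ ′-swap ′-swap
    ; comm         = +-comm
    ; assoc-def    = +-assoc-def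
    ; assoc        = +-assoc
    ; compl-def    = λ x → ≤-′′ʳ (≤-refl x)
    ; compl        = +-compl
    ; compl-unique = +-compl-unique
    ; zero-one     = +-zero-one
    }

  x≤x+y : ∀ {x y} → Def+ x y → x ≤ x + y
  x≤x+y {x} {y} x≤y′ =
    subst (_≤ x + y) (′-invol x) (′-antitone (⊙-≤ˡ (Equivalence.to Def+⇔Def⊙ x≤y′)))

  ≤⇔InducedLe : ∀ x y → x ≤ y ⇔ InducedLe Def+ _+_ x y
  ≤⇔InducedLe x y = mk⇔ (λ x≤y → D-′⇒InducedLe (≤-′′ʳ x≤y)) (λ { (z , x≤z′ , refl) → x≤x+y x≤z′ })
    where open EffectAlgebraProperties +-isEffectAlgebra

theorem2 : (C : CURPoset) →
    IsEffectAlgebra (Derived.Def+ C) (Derived._+_ C) (CURPoset._′ C) (CURPoset.𝟘 C) (CURPoset.𝟙 C)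
    × (∀ x y → CURPoset._≤_ C x y ⇔ InducedLe (Derived.Def+ C) (Derived._+_ C) x y)
theorem2 C = +-isEffectAlgebra , ≤⇔InducedLe
  where open CURPosetProperties C
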